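{- Let $G=(V,E)$ be a multigraph, $e\in E$, $k\ge\Delta(G)+1$, $T$ a tree sequence with respect to $G$ and $e$, $C\subseteq[k]$, and $\varphi$ a $k$-edge-coloring of $G-e$. Suppose $|V(T)|$ is odd and $V(T)$ is closed but not strongly closed with respect to $\varphi$, and let $\pi$ be a $(T,C,\varphi)$-stable coloring. Then $V(T)$ is also closed but not strongly closed with respect to $\pi$.
   Context: Multigraphs are finite, loopless, parallel edges allowed; $\Delta(G)$ is the maximum degree; $[k]=\{1,\dots,k\}$. A $k$-edge-coloring of $G-e$ is a map from $E-\{e\}$ to $[k]$ giving adjacent edges distinct colors; for such $\pi$, $\overline{\pi}(v)$ is the set of colors of $[k]$ missing at $v$ and $\overline{\pi}(X)=\bigcup_{v\in X}\overline{\pi}(v)$. $\partial(X)$ is the set of edges with exactly one end in $X$. A set $X$ is closed with respect to $\pi$ if no edge of $\partial(X)-\{e\}$ has a color in $\overline{\pi}(X)$, and strongly closed if moreover any two distinct edges of $\partial(X)-\{e\}$ receive distinct colors. A tree sequence with respect to $G$ and $e$ is a sequence $T=(y_0,e_1,y_1,\dots,e_p,y_p)$, $p\ge1$, of distinct vertices and distinct edges with $e_1=e$ and each $e_j$ joining $y_j$ to some $y_i$, $i<j$; $V(T)=\{y_0,\dots,y_p\}$. A $k$-edge-coloring $\pi$ of $G-e$ is $(T,C,\varphi)$-stable if (i) $\pi(f)=\varphi(f)$ for every edge $f\ne e$ incident to $V(T)$ with $\varphi(f)\in\overline{\varphi}(V(T))\cup C$, and (ii) $\overline{\pi}(v)=\overline{\varphi}(v)$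 for all $v\in V(T)$. -}

module Defs where

open import Data.Nat using (ℕ; zero; suc; _+_; _≤_; _<_; _%_)
open import Data.Fin using (Fin; toℕ; _≟_)
import Data.Fin as F
open import Data.Fin.Subset using (Subset; _∈_)
open import Data.Product using (Σ; ∃; ∃-syntax; _×_; _,_; proj₁; proj₂)
open import Data.Sum using (_⊎_)
open import Data.List using (List; length; filter)
open import Data.List using () renaming (allFin to allFinL)
open import Data.Empty using (⊥)
open import Relation.Nullary using (¬_; Dec)
open import Relation.Nullary.Decidable using (_⊎-dec_)
open import Relation.Binary.PropositionalEquality using (_≡_; _≢_)
open import Function.Definitions using (Injective)

record Multigraph : Set where
  field
    n        : ℕ
    m        : ℕ
    ends     : Fin m → Fin n × Fin n
    loopless : ∀ f → proj₁ (ends f) ≢ proj₂ (ends f)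

module _ (G : Multigraph) where
  open Multigraph G

  Vertex : Set
  Vertex = Fin n

  Edge : Set
  Edge = Fin m

  Incident : Edge → Vertex → Set
  Incident f v = (proj₁ (ends f) ≡ v) ⊎ (proj₂ (ends f) ≡ v)

  incident? : ∀ v f → Dec (Incident f v)
  incident? v f = (proj₁ (ends f) ≟ v) ⊎-dec (proj₂ (ends f) ≟ v)

  Joins : Edge → Vertex → Vertex → Set
  Joins f u w = (proj₁ (ends f) ≡ u × proj₂ (ends f) ≡ w)
              ⊎ (proj₁ (ends f) ≡ w × proj₂ (ends f) ≡ u)

  deg : Vertex → ℕ
  deg v = length (filter (incident? v) (allFinL m))

  -- Δ(G) + 1 ≤ k, i.e. every vertex has degree at most k - 1
  -- (Δ(G) is the maximum of the degrees)
  MaxDegreeBelow : ℕ → Set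
  MaxDegreeBelow k = ∀ v → deg v + 1 ≤ k

  -- A "k-edge-coloring of G - e": colours [k] are represented by Fin k.
  -- The map is given on all edges but its value on e is never used.
  IsEdgeColoringMinus : (k : ℕ) → Edge → (Edge → Fin k) → Set
  IsEdgeColoringMinus k e π =
    ∀ f g → f ≢ e → g ≢ e → f ≢ g → (∃[ v ] (Incident f v × Incident g v)) → π f ≢ π g

  Missing : {k : ℕ} → Edge → (Edge → Fin k) → Vertex → Fin k → Set
  Missing e π v c = ∀ f → f ≢ e → Incident f v → π f ≢ c

  MissingSet : {k : ℕ} → Edge → (Edge → Fin k) → (Vertex → Set) → Fin k → Set
  MissingSet e π X c = ∃[ v ] (X v × Missing e π v c)

  Boundary : (Vertex → Set) → Edge → Set
  Boundary X f = (X (proj₁ (ends f)) × ¬ X (proj₂ (ends f)))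
               ⊎ (¬ X (proj₁ (ends f)) × X (proj₂ (ends f)))

  Closed : {k : ℕ} → Edge → (Edge → Fin k) → (Vertex → Set) → Set
  Closed e π X = ∀ f → f ≢ e → Boundary X f → ¬ MissingSet e π X (π f)

  StronglyClosed : {k : ℕ} → Edge → (Edge → Fin k) → (Vertex → Set) → Set
  StronglyClosed e π X =
    Closed e π X ×
    (∀ f g → f ≢ e → g ≢ e → Boundary X f → Boundary X g → f ≢ g → π f ≢ π g)

  -- Tree sequence (y₀, e₁, y₁, …, e_p, y_p) w.r.t. G and e, with p ≥ 1.
  -- ys i = y_i (i = 0..p), es j = e_{j+1} (j = 0..p-1).
  record TreeSequence (e : Edge) : Set where
    field
      p        : ℕ
      p≥1      : 1 ≤ p
      ys       : Fin (suc p) → Vertex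
      es       : Fin p → Edge
      ys-inj   : Injective _≡_ _≡_ ys
      es-inj   : Injective _≡_ _≡_ es
      first    : ∀ (j : Fin p) → toℕ j ≡ 0 → es j ≡ e
      joins    : ∀ (j : Fin p) → ∃[ i ] (toℕ i < suc (toℕ j) × Joins (es j) (ys (F.suc j)) (ys i) )

  VT : {e : Edge} → TreeSequence e → Vertex → Set
  VT T v = ∃[ i ] (TreeSequence.ys T i ≡ v)

  -- |V(T)| = p + 1 (the y_i are distinct)
  sizeVT : {e : Edge} → TreeSequence e → ℕ
  sizeVT T = suc (TreeSequence.p T)

  Stable : {k : ℕ} {e : Edge} → TreeSequence e → Subset k → (Edge → Fin k) → (Edge → Fin k) → Set
  Stable {k} {e} T C φ π =
    (∀ f → f ≢ e → (∃[ v ] (VT T v × Incident f v)) →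
       (MissingSet e φ (VT T) (φ f) ⊎ φ f ∈ C) → π f ≡ φ f)
    ×
    (∀ v → VT T v → ∀ c → (Missing e π v c → Missing e φ v c) × (Missing e φ v c → Missing e π v c))

-- Stability preserves the missing colours at V(T) and the colours of the edges at V(T) that
-- carry a colour of φ̄(V(T)); closedness transfers directly from this. For strong closedness,
-- count the boundary edges B: as |V(T)| is odd, every colour outside φ̄(V(T)) is the φ-colour of
-- an edge of B, so an injective π on B, with values outside π̄(V(T)) = φ̄(V(T)), would inject B
-- into the set of φ-colours of B, which a φ-collision makes smaller than B.
module Submission where

open import Defs
open import Data.Nat using (ℕ; zero; suc; _≤_; z≤n; s≤s; _%_)
open import Data.Nat.Properties using (suc-injective; 0≢1+n; 1+n≰n)
open import Data.Fin using (Fin; _≟_)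
open import Data.Fin.Properties using (any?)
open import Data.Fin.Subset using (Subset)
open import Data.List using (List; []; _∷_; length; map; filter; allFin)
open import Data.List.Properties using (length-map; length-tabulate; length-removeAt′)
open import Data.List.Membership.Propositional using (_∈_; _∉_; _─_)
open import Data.List.Membership.Propositional.Properties
  using (∈-map⁺; ∈-map⁻; ∈-filter⁺; ∈-filter⁻; ∈-allFin)
open import Data.List.Relation.Unary.Any using (here; there; index)
import Data.List.Relation.Unary.All as All
import Data.List.Relation.Unary.All.Properties as All
open import Data.List.Relation.Unary.AllPairs using (_∷_)
open import Data.List.Relation.Unary.Unique.Propositional using (Unique)
import Data.List.Relation.Unary.Unique.Propositional.Properties as Unique
open import Data.Product using (∃-syntax; _×_; _,_; proj₁; proj₂)
open import Data.Sum using (inj₁; inj₂)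
open import Data.Empty using (⊥-elim)
open import Relation.Nullary using (¬_; yes; no)
open import Relation.Nullary.Decidable using (_×-dec_; _⊎-dec_; ¬?; decidable-stable)
open import Relation.Unary using (Decidable)
open import Relation.Binary.Definitions using (Symmetric; DecidableEquality)
open import Relation.Binary.PropositionalEquality
  using (_≡_; _≢_; refl; sym; trans; cong; subst; subst₂)

module _ {a} {A : Set a} {x : A} where

  ∈-─⁺ : ∀ {xs y} (p : x ∈ xs) → y ∈ xs → y ≢ x → y ∈ xs ─ p
  ∈-─⁺ (here refl) (here refl) y≢x = ⊥-elim (y≢x refl)
  ∈-─⁺ (here refl) (there q)   _   = q
  ∈-─⁺ (there p)   (here refl) _   = here refl
  ∈-─⁺ (there p)   (there q)   y≢x = there (∈-─⁺ p q y≢x)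

  ∈-─⁻ : ∀ {xs y} (p : x ∈ xs) → y ∈ xs ─ p → y ∈ xs
  ∈-─⁻ (here refl) q         = there q
  ∈-─⁻ (there p)   (here eq) = here eq
  ∈-─⁻ (there p)   (there q) = there (∈-─⁻ p q)

  ∉-─ : ∀ {xs} → Unique xs → (p : x ∈ xs) → x ∉ xs ─ p
  ∉-─ (x∉ ∷ _) (here refl) q         = All.lookup x∉ q refl
  ∉-─ (y∉ ∷ _) (there p)   (here refl) = All.lookup y∉ p refl
  ∉-─ (_ ∷ u)  (there p)   (there q) = ∉-─ u p q

  Unique-─ : ∀ {xs} → Unique xs → (p : x ∈ xs) → Unique (xs ─ p)
  Unique-─ (_ ∷ u)   (here refl) = u
  Unique-─ (y∉ ∷ u)  (there p)   = All.─⁺ p y∉ ∷ Unique-─ u p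

  length-─ : ∀ {xs} (p : x ∈ xs) → length xs ≡ suc (length (xs ─ p))
  length-─ {xs} p = length-removeAt′ xs (index p)

module _ {a b} {A : Set a} {B : Set b} where

  InjectiveOn : (A → B) → List A → Set _
  InjectiveOn f xs = ∀ {x y} → x ∈ xs → y ∈ xs → f x ≡ f y → x ≡ y

  injectiveOn⇒length≤ : ∀ (f : A → B) {xs ys} → Unique xs → InjectiveOn f xs →
                        (∀ {x} → x ∈ xs → f x ∈ ys) → length xs ≤ length ys
  injectiveOn⇒length≤ f {[]}     _          _   _    = z≤n
  injectiveOn⇒length≤ f {x ∷ xs} {ys} (x∉ ∷ u) inj into =
    subst (suc (length xs) ≤_) (sym (length-─ fx∈ys))
      (s≤s (injectiveOn⇒length≤ f u (λ p q → inj (there p) (there q)) into′))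
    where
    fx∈ys = into (here refl)
    into′ : ∀ {z} → z ∈ xs → f z ∈ ys ─ fx∈ys
    into′ z∈xs = ∈-─⁺ fx∈ys (into (there z∈xs))
      (λ fz≡fx → All.lookup x∉ z∈xs (sym (inj (there z∈xs) (here refl) fz≡fx)))

  collision⇒∈-map-─ : DecidableEquality A → (f : A → B) {xs : List A} {x x′ : A}
                      (p : x ∈ xs) → x′ ∈ xs → x′ ≢ x → f x′ ≡ f x →
                      ∀ {y} → y ∈ xs → f y ∈ map f (xs ─ p)
  collision⇒∈-map-─ _≟_ f {x = x} p x′∈ x′≢x fx′≡fx {y} y∈ with y ≟ x
  ... | yes refl = subst (_∈ map f (_ ─ p)) fx′≡fx (∈-map⁺ f (∈-─⁺ p x′∈ x′≢x))
  ... | no y≢x   = ∈-map⁺ f (∈-─⁺ p y∈ y≢x)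

Matched : ∀ {a r} {A : Set a} → (A → A → Set r) → List A → Set _
Matched R xs = ∀ {x} → x ∈ xs → ∃[ y ] (y ∈ xs × R x y)

module _ {a r} {A : Set a} {R : A → A → Set r} (R-sym : Symmetric R)
         (R-irrefl : ∀ {x} → ¬ R x x) (R-functional : ∀ {x y z} → R x y → R x z → y ≡ z) where

  matched⇒even : ∀ {xs} → Unique xs → Matched R xs → length xs % 2 ≡ 0
  matched⇒even = go _ refl
    where
    go : ∀ n {xs} → length xs ≡ n → Unique xs → Matched R xs → n % 2 ≡ 0
    go zero          _   _ _ = refl
    go (suc n) {[]} () _ _
    go (suc n) {x ∷ rest} len u matched with matched (here refl)
    ... | _ , here refl , Rxx = ⊥-elim (R-irrefl Rxx)
    go (suc zero)    {x ∷ []}    len u matched | _ , there () , _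
    go (suc (suc n)) {x ∷ rest} len u@(_ ∷ u′) matched | y , there p , Rxy =
      go n (suc-injective (trans (sym (length-─ p)) (suc-injective len)))
           (Unique-─ u′ p) matched′
      where
      x∉rest = Unique.Unique[x∷xs]⇒x∉xs u
      matched′ : Matched R (rest ─ p)
      matched′ {z} z∈ with matched (there (∈-─⁻ p z∈))
      ... | w , here refl , Rzx =
        ⊥-elim (∉-─ u′ p (subst (_∈ rest ─ p) (R-functional (R-sym Rzx) Rxy) z∈))
      ... | w , there w∈rest , Rzw = w , ∈-─⁺ p w∈rest w≢y , Rzw
        where
        w≢y : w ≢ y
        w≢y refl = x∉rest (subst (_∈ rest) (R-functional (R-sym Rzw) (R-sym Rxy)) (∈-─⁻ p z∈))

module _ (G : Multigraph) where
  open Multigraph G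

  Joins-sym : ∀ {f u v} → Joins G f u v → Joins G f v u
  Joins-sym (inj₁ (a , b)) = inj₂ (a , b)
  Joins-sym (inj₂ (a , b)) = inj₁ (a , b)

  Joins-irrefl : ∀ {f v} → ¬ Joins G f v v
  Joins-irrefl {f} (inj₁ (a , b)) = loopless f (trans a (sym b))
  Joins-irrefl {f} (inj₂ (a , b)) = loopless f (trans a (sym b))

  Joins-functional : ∀ {f u v w} → Joins G f u v → Joins G f u w → v ≡ w
  Joins-functional (inj₁ (a , b)) (inj₁ (a′ , b′)) = trans (sym b) b′
  Joins-functional (inj₁ (a , b)) (inj₂ (a′ , b′)) = trans (sym b) (trans b′ (trans (sym a) a′))
  Joins-functional (inj₂ (a , b)) (inj₁ (a′ , b′)) = trans (sym a) (trans a′ (trans (sym b) b′))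
  Joins-functional (inj₂ (a , b)) (inj₂ (a′ , b′)) = trans (sym a) a′

  Joins⇒Incident : ∀ {f u v} → Joins G f u v → Incident G f u
  Joins⇒Incident (inj₁ (a , _)) = inj₁ a
  Joins⇒Incident (inj₂ (_ , b)) = inj₂ b

  Incident⇒Joins : ∀ {f u} → Incident G f u → ∃[ v ] Joins G f u v
  Incident⇒Joins (inj₁ a) = _ , inj₁ (a , refl)
  Incident⇒Joins (inj₂ b) = _ , inj₂ (refl , b)

  module _ {X : Vertex G → Set} where

    Joins⇒Boundary : ∀ {f u v} → Joins G f u v → X u → ¬ X v → Boundary G X f
    Joins⇒Boundary (inj₁ (refl , refl)) Xu ¬Xv = inj₁ (Xu , ¬Xv)
    Joins⇒Boundary (inj₂ (refl , refl)) Xu ¬Xv = inj₂ (¬Xv , Xu)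

    Boundary⇒Incident : ∀ {f} → Boundary G X f → ∃[ u ] (X u × Incident G f u)
    Boundary⇒Incident (inj₁ (Xu , _)) = _ , Xu , inj₁ refl
    Boundary⇒Incident (inj₂ (_ , Xu)) = _ , Xu , inj₂ refl

    Boundary? : Decidable X → Decidable (Boundary G X)
    Boundary? X? f = (X? (proj₁ (ends f)) ×-dec ¬? (X? (proj₂ (ends f))))
                ⊎-dec (¬? (X? (proj₁ (ends f))) ×-dec X? (proj₂ (ends f)))

module _ (G : Multigraph) (e : Edge G) {k : ℕ} where
  open Multigraph G

  DistinctOnBoundary : (Vertex G → Set) → (Edge G → Fin k) → Set
  DistinctOnBoundary X π =
    ∀ f g → f ≢ e → g ≢ e → Boundary G X f → Boundary G X g → f ≢ g → π f ≢ π g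

  ¬Missing⇒edge : ∀ {φ : Edge G → Fin k} {v c} → ¬ Missing G e φ v c →
                  ∃[ f ] (f ≢ e × Incident G f v × φ f ≡ c)
  ¬Missing⇒edge {φ} {v} {c} ¬missing =
    decidable-stable (any? λ f → ¬? (f ≟ e) ×-dec incident? G v f ×-dec (φ f ≟ c))
      λ none → ¬missing λ f f≢e f-at-v φf≡c → none (f , f≢e , f-at-v , φf≡c)

  -- The edges of colour c pair up the vertices of X unless one of them leaves X.
  module _ {φ : Edge G → Fin k} (φ-colouring : IsEdgeColoringMinus G k e φ)
           {X : Vertex G → Set} (X? : Decidable X) {xs : List (Vertex G)}
           (∈⇒X : ∀ {v} → v ∈ xs → X v) (X⇒∈ : ∀ {v} → X v → v ∈ xs)
           (xs-unique : Unique xs) (xs-odd : length xs % 2 ≡ 1) where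

    JoinedInColour : Fin k → Vertex G → Vertex G → Set
    JoinedInColour c u v = ∃[ f ] (f ≢ e × φ f ≡ c × Joins G f u v)

    JoinedInColour-functional : ∀ {c u v w} → JoinedInColour c u v → JoinedInColour c u w → v ≡ w
    JoinedInColour-functional (f , f≢e , φf≡c , jf) (g , g≢e , φg≡c , jg) with f ≟ g
    ... | yes refl = Joins-functional G jf jg
    ... | no f≢g   = ⊥-elim (φ-colouring f g f≢e g≢e f≢g
                       (_ , Joins⇒Incident G jf , Joins⇒Incident G jg) (trans φf≡c (sym φg≡c)))

    present⇒boundaryEdge : ∀ c → ¬ MissingSet G e φ X c →
                           ∃[ f ] (f ≢ e × Boundary G X f × φ f ≡ c)
    present⇒boundaryEdge c c∉φ̄X =
      decidable-stable (any? λ f → ¬? (f ≟ e) ×-dec Boundary? G X? f ×-dec (φ f ≟ c))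
        λ none → 0≢1+n (trans (sym (matched⇒even
                   (λ (f , f≢e , φf≡c , j) → f , f≢e , φf≡c , Joins-sym G j)
                   (λ (_ , _ , _ , j) → Joins-irrefl G j)
                   JoinedInColour-functional xs-unique (matched none))) xs-odd)
      where
      matched : ¬ (∃[ f ] (f ≢ e × Boundary G X f × φ f ≡ c)) → Matched (JoinedInColour c) xs
      matched none {v} v∈xs with ¬Missing⇒edge (λ missing → c∉φ̄X (v , ∈⇒X v∈xs , missing))
      ... | f , f≢e , f-at-v , φf≡c with Incident⇒Joins G f-at-v
      ...   | w , j with X? w
      ...     | yes Xw = w , X⇒∈ Xw , f , f≢e , φf≡c , j
      ...     | no ¬Xw = ⊥-elim (none (f , f≢e , Joins⇒Boundary G j (∈⇒X v∈xs) ¬Xw , φf≡c))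

  module _ (T : TreeSequence G e) where
    open TreeSequence T

    VT? : Decidable (VT G T)
    VT? v = any? λ i → ys i ≟ v

    vertices : List (Vertex G)
    vertices = map ys (allFin (suc p))

    ∈vertices⇒VT : ∀ {v} → v ∈ vertices → VT G T v
    ∈vertices⇒VT v∈ with ∈-map⁻ ys v∈
    ... | i , _ , v≡yᵢ = i , sym v≡yᵢ

    VT⇒∈vertices : ∀ {v} → VT G T v → v ∈ vertices
    VT⇒∈vertices (i , refl) = ∈-map⁺ ys (∈-allFin i)

    vertices-unique : Unique vertices
    vertices-unique = Unique.map⁺ ys-inj (Unique.allFin⁺ (suc p))

    length-vertices : length vertices ≡ sizeVT G T
    length-vertices = trans (length-map ys (allFin (suc p))) (length-tabulate (λ i → i))

  module _ (T : TreeSequence G e) (C : Subset k) {φ π : Edge G → Fin k}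
           (stable : Stable G T C φ π) where

    private
      X = VT G T

    MissingSet-π⇒φ : ∀ {c} → MissingSet G e π X c → MissingSet G e φ X c
    MissingSet-π⇒φ {c} (v , Xv , missing) = v , Xv , proj₁ (proj₂ stable v Xv c) missing

    MissingSet-φ⇒π : ∀ {c} → MissingSet G e φ X c → MissingSet G e π X c
    MissingSet-φ⇒π {c} (v , Xv , missing) = v , Xv , proj₂ (proj₂ stable v Xv c) missing

    -- π agrees with φ on the edges at X whose φ-colour lies in φ̄(X), so such an edge at an
    -- end of a boundary edge f would clash with f under π.
    boundaryColour-missingAtEnd : Closed G e φ X → IsEdgeColoringMinus G k e π →
      ∀ {f u c} → f ≢ e → Boundary G X f → X u → Incident G f u →
      π f ≡ c → MissingSet G e φ X c → Missing G e φ u c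
    boundaryColour-missingAtEnd φ-closed π-colouring {f} {u} f≢e ∂f Xu f-at-u πf≡c c∈φ̄X g g≢e g-at-u refl
      with f ≟ g
    ... | yes refl = φ-closed f f≢e ∂f c∈φ̄X
    ... | no f≢g   = π-colouring f g f≢e g≢e f≢g (u , f-at-u , g-at-u)
          (trans πf≡c (sym (proj₁ stable g g≢e (u , Xu , g-at-u) (inj₁ c∈φ̄X))))

    closed-stable : Closed G e φ X → IsEdgeColoringMinus G k e π → Closed G e π X
    closed-stable φ-closed π-colouring f f≢e ∂f πf∈π̄X
      with u , Xu , f-at-u ← Boundary⇒Incident G {X = X} ∂f =
      proj₂ (proj₂ stable u Xu (π f))
        (boundaryColour-missingAtEnd φ-closed π-colouring f≢e ∂f Xu f-at-u refl (MissingSet-π⇒φ πf∈π̄X))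
        f f≢e f-at-u refl

    distinctOnBoundary-stable : IsEdgeColoringMinus G k e φ → sizeVT G T % 2 ≡ 1 →
      Closed G e π X → DistinctOnBoundary X π → DistinctOnBoundary X φ
    distinctOnBoundary-stable φ-colouring odd π-closed π-distinct f g f≢e g≢e ∂f ∂g f≢g φf≡φg =
      1+n≰n (subst₂ _≤_ (length-─ g∈B) (length-map φ (B ─ g∈B))
               (injectiveOn⇒length≤ π B-unique π-injective π-into))
      where
      InB : Edge G → Set
      InB h = h ≢ e × Boundary G X h

      B : List (Edge G)
      B = filter (λ h → ¬? (h ≟ e) ×-dec Boundary? G (VT? T) h) (allFin m)

      B-unique : Unique B
      B-unique = Unique.filter⁺ _ (Unique.allFin⁺ m)

      ∈B⁺ : ∀ {h} → InB h → h ∈ B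
      ∈B⁺ {h} = ∈-filter⁺ _ (∈-allFin h)

      ∈B⁻ : ∀ {h} → h ∈ B → InB h
      ∈B⁻ h∈B = proj₂ (∈-filter⁻ _ {xs = allFin m} h∈B)

      g∈B = ∈B⁺ (g≢e , ∂g)

      π-injective : InjectiveOn π B
      π-injective {h} {h′} h∈B h′∈B πh≡πh′ with h ≟ h′
      ... | yes h≡h′ = h≡h′
      ... | no h≢h′  = ⊥-elim (π-distinct h h′ (proj₁ (∈B⁻ h∈B)) (proj₁ (∈B⁻ h′∈B))
                                (proj₂ (∈B⁻ h∈B)) (proj₂ (∈B⁻ h′∈B)) h≢h′ πh≡πh′)

      present⇒boundaryEdge-VT : ∀ c → ¬ MissingSet G e φ X c →
                                ∃[ h ] (h ≢ e × Boundary G X h × φ h ≡ c)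
      present⇒boundaryEdge-VT =
        present⇒boundaryEdge φ-colouring (VT? T) (∈vertices⇒VT T) (VT⇒∈vertices T)
          (vertices-unique T) (trans (cong (_% 2) (length-vertices T)) odd)

      π-into : ∀ {h} → h ∈ B → π h ∈ map φ (B ─ g∈B)
      π-into {h} h∈B
        with h′ , h′≢e , ∂h′ , φh′≡πh ← present⇒boundaryEdge-VT (π h)
               (λ πh∈φ̄X → π-closed h (proj₁ (∈B⁻ h∈B)) (proj₂ (∈B⁻ h∈B)) (MissingSet-φ⇒π πh∈φ̄X)) =
        subst (_∈ map φ (B ─ g∈B)) φh′≡πh
          (collision⇒∈-map-─ _≟_ φ g∈B (∈B⁺ (f≢e , ∂f)) f≢g φf≡φg (∈B⁺ (h′≢e , ∂h′)))

lemma2p8 : (G : Multigraph) (e : Edge G) (k : ℕ) → MaxDegreeBelow G k →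
    (T : TreeSequence G e) (C : Subset k) (φ π : Edge G → Fin k) →
    IsEdgeColoringMinus G k e φ →
    sizeVT G T % 2 ≡ 1 →
    Closed G e φ (VT G T) → ¬ StronglyClosed G e φ (VT G T) →
    IsEdgeColoringMinus G k e π →
    Stable G T C φ π →
    Closed G e π (VT G T) × ¬ StronglyClosed G e π (VT G T)
lemma2p8 G e k _ T C φ π φ-colouring odd φ-closed φ-notStronglyClosed π-colouring stable =
  π-closed , λ (_ , π-distinct) →
    φ-notStronglyClosed (φ-closed , distinctOnBoundary-stable G e T C stable φ-colouring odd π-closed π-distinct)
  where
  π-closed : Closed G e π (VT G T)
  π-closed = closed-stable G e T C stable φ-closed π-colouring
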